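{- Let $a,b$ be positive integers, $\epsilon_a,\epsilon_b\in\{+1,-1\}$, and let $I=(\delta_1u_1,\dots,\delta_pu_p)$ and $K=(\eta_1v_1,\dots,\eta_qv_q)$ be finite (possibly empty) signed sequences of positive integers $u_i,v_j$ with signs $\delta_i,\eta_j\in\{\pm1\}$. Suppose the Cycle Equation $\epsilon_aa+\sum_i\delta_iu_i+\epsilon_bb+\sum_j\eta_jv_j=0$ holds. Then the signed pattern $[\epsilon_aa,\delta_1u_1,\dots,\delta_pu_p,\epsilon_bb]$ satisfies the Divisibility and Parity conditions if and only if the signed pattern $[\epsilon_bb,\eta_1v_1,\dots,\eta_qv_q,\epsilon_aa]$ satisfies the Divisibility and Parity conditions.
   Context: $\nu_2(n)$ denotes the exponent of $2$ in the positive integer $n$. For a signed pattern $[\epsilon_1b_1,\dots,\epsilon_mb_m]$ ($m\ge2$, $b_k$ positive integers, $\epsilon_k\in\{\pm1\}$), let $g=\gcd(b_1,b_m)$ and $I=\sum_{k=2}^{m-1}\epsilon_kb_k$ ($I=0$ if $m=2$). Divisibility condition: $g\mid I$. Parity condition (given Divisibility): $I/g$ is even if and only if the statement "if $\nu_2(b_1)<\nu_2(b_m)$ then $\epsilon_1=-1$; if $\nu_2(b_1)>\nu_2(b_m)$ then $\epsilon_m=+1$; if $\nu_2(b_1)=\nu_2(b_m)$ then $\epsilon_1=-\epsilon_m$" holds. -}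

module Defs where

open import Data.Nat as ℕ using (ℕ; zero; suc; _<_; _≡ᵇ_; _%_; _/_)
open import Data.Nat.GCD using (gcd)
open import Data.Integer as ℤ using (ℤ; +_; -_)
open import Data.Integer.Divisibility as ℤD using ()
open import Data.List using (List; []; _∷_; foldr)
open import Data.Product using (_×_; ∃)
open import Relation.Binary.PropositionalEquality using (_≡_; _≢_)
open import Data.Bool using (true; false)

data Sign : Set where
  plus minus : Sign

negSign : Sign → Sign
negSign plus  = minus
negSign minus = plus

-- A signed positive integer ε·b, with b = suc n (so b ≥ 1 is built in).
record SignedPos : Set where
  constructor _·_
  field
    sgn : Sign
    pred-mag : ℕ
open SignedPos public

mag : SignedPos → ℕ
mag x = suc (pred-mag x)

val : SignedPos → ℤ
val (plus · n)  = + suc n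
val (minus · n) = - (+ suc n)

sumVal : List SignedPos → ℤ
sumVal = foldr (λ x s → val x ℤ.+ s) (+ 0)

-- 2-adic valuation ν₂(n) for n ≥ 1: number of times 2 divides n.
-- Implemented with fuel (ν₂(n) < n, so fuel n suffices).
ν₂-fuel : ℕ → ℕ → ℕ
ν₂-fuel zero    n = 0
ν₂-fuel (suc f) zero = 0
ν₂-fuel (suc f) (suc m) with (suc m % 2) ≡ᵇ 0
... | true  = suc (ν₂-fuel f (suc m / 2))
... | false = 0

ν₂ : ℕ → ℕ
ν₂ n = ν₂-fuel n n

-- A signed pattern [ε₁b₁, ε₂b₂, …, ε_{m-1}b_{m-1}, ε_m b_m] with m ≥ 2:
-- first entry, list of interior entries, last entry.
record Pattern : Set where
  constructor pat
  field
    first  : SignedPos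
    inner  : List SignedPos
    last   : SignedPos
open Pattern public

gcdEnds : Pattern → ℕ
gcdEnds P = gcd (mag (first P)) (mag (last P))

interiorSum : Pattern → ℤ
interiorSum P = sumVal (inner P)

Divisibility : Pattern → Set
Divisibility P = (+ gcdEnds P) ℤD.∣ interiorSum P

-- I/g is even (g ≥ 1, so the quotient k with I = k·g is unique)
QuotEven : Pattern → Set
QuotEven P = ∃ λ k → (interiorSum P ≡ k ℤ.* (+ gcdEnds P)) × ((+ 2) ℤD.∣ k)

SignRule : Pattern → Set
SignRule P =
  (ν₂ b₁ < ν₂ bₘ → ε₁ ≡ minus) ×
  (ν₂ bₘ < ν₂ b₁ → εₘ ≡ plus) ×
  (ν₂ b₁ ≡ ν₂ bₘ → ε₁ ≡ negSign εₘ)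
  where
    b₁ = mag (first P)
    bₘ = mag (last P)
    ε₁ = sgn (first P)
    εₘ = sgn (last P)

Parity : Pattern → Set
Parity P = Divisibility P → (QuotEven P → SignRule P) × (SignRule P → QuotEven P)

DivPar : Pattern → Set
DivPar P = Divisibility P × Parity P

-- Let g = gcd(a,b), a = a′g, b = b′g and I = kg. The cycle equation gives K = k′g with
-- k′ = -(k + εₐa′ + ε_b b′), so Divisibility transfers and k′ ≡ k + a′ + b′ (mod 2). As a′ and b′
-- are coprime, a′ + b′ is even iff both are odd iff ν₂(a) = ν₂(b). In that case the two sign rules
-- coincide and k, k′ have the same parity; otherwise exactly one of the sign rules holds and k, k′
-- have opposite parities. Either way Parity transfers; the converse is the rotated cycle.

module Submission where

module Valuation where

  open import Defs using (ν₂-fuel; ν₂)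
  open import Data.Nat
  open import Data.Nat.Properties
  open import Data.Nat.DivMod using (_/_; _%_; m/n<m; m*n%n≡0; m*n/n≡m; [m+kn]%n≡m%n)
  open import Data.Nat.Induction using (<-wellFounded)
  open import Data.Nat.Tactic.RingSolver using (solve-∀)
  open import Data.Bool using (true; false)
  open import Data.Product using (∃₂; _,_)
  open import Induction.WellFounded using (Acc; acc)
  open import Relation.Binary.PropositionalEquality
  open ≡-Reasoning

  data ParityView : ℕ → Set where
    even : ∀ j → ParityView (j * 2)
    odd  : ∀ j → ParityView (suc (j * 2))

  parityView : ∀ n → ParityView n
  parityView zero = even 0
  parityView (suc n) with parityView n
  ... | even j = odd j
  ... | odd j  = even (suc j)

  ν₂-fuel-zero : ∀ f → ν₂-fuel f 0 ≡ 0
  ν₂-fuel-zero zero    = refl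
  ν₂-fuel-zero (suc f) = refl

  ν₂-fuel-irrelevant : ∀ {f f′ n} → n ≤ f → n ≤ f′ → ν₂-fuel f n ≡ ν₂-fuel f′ n
  ν₂-fuel-irrelevant {zero}  {f′} z≤n _ = sym (ν₂-fuel-zero f′)
  ν₂-fuel-irrelevant {suc f} {zero} _ z≤n = ν₂-fuel-zero (suc f)
  ν₂-fuel-irrelevant {suc f} {suc f′} {zero} _ _ = refl
  ν₂-fuel-irrelevant {suc f} {suc f′} {suc m} (s≤s m≤f) (s≤s m≤f′)
    with suc m % 2 ≡ᵇ 0
  ... | true  = cong suc (ν₂-fuel-irrelevant (half≤ m≤f) (half≤ m≤f′))
    where
    half≤ : ∀ {h} → m ≤ h → suc m / 2 ≤ h
    half≤ m≤h = ≤-trans (≤-pred (m/n<m (suc m) 2 (s≤s (s≤s z≤n)))) m≤h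
  ... | false = refl

  ν₂-odd : ∀ j → ν₂ (suc (j * 2)) ≡ 0
  ν₂-odd j rewrite [m+kn]%n≡m%n 1 j 2 {{_}} = refl

  ν₂-double : ∀ n .{{_ : NonZero n}} → ν₂ (n * 2) ≡ suc (ν₂ n)
  ν₂-double n@(suc m) rewrite m*n%n≡0 n 2 {{_}} | m*n/n≡m n 2 {{_}} =
    cong suc (ν₂-fuel-irrelevant (s≤s (m≤m*n m 2)) ≤-refl)

  2^[1+k]*o≡2^k*o*2 : ∀ k o → 2 ^ suc k * o ≡ 2 ^ k * o * 2
  2^[1+k]*o≡2^k*o*2 k o = lemma (2 ^ k) o
    where
    lemma : ∀ p o → 2 * p * o ≡ p * o * 2
    lemma = solve-∀

  ν₂-2^k*odd : ∀ k j → ν₂ (2 ^ k * suc (j * 2)) ≡ k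
  ν₂-2^k*odd zero    j = trans (cong ν₂ (*-identityˡ (suc (j * 2)))) (ν₂-odd j)
  ν₂-2^k*odd (suc k) j = begin
    ν₂ (2 ^ suc k * o)   ≡⟨ cong ν₂ (2^[1+k]*o≡2^k*o*2 k o) ⟩
    ν₂ (2 ^ k * o * 2)   ≡⟨ ν₂-double (2 ^ k * o) {{m*n≢0 (2 ^ k) o {{m^n≢0 2 k}}}} ⟩
    suc (ν₂ (2 ^ k * o)) ≡⟨ cong suc (ν₂-2^k*odd k j) ⟩
    suc k                ∎
    where o = suc (j * 2)

  odd-part : ∀ n .{{_ : NonZero n}} → ∃₂ λ k j → n ≡ 2 ^ k * suc (j * 2)
  odd-part (suc n) = go n (<-wellFounded (suc n))
    where
    go : ∀ n → Acc _<_ (suc n) → ∃₂ λ k j → suc n ≡ 2 ^ k * suc (j * 2)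
    go n (acc rec) with parityView n
    ... | even j = 0 , j , sym (+-identityʳ _)
    ... | odd j with go j (rec (s≤s (s≤s (m≤m*n j 2))))
    ...   | k , i , e = suc k , i , (begin
      suc j * 2            ≡⟨ cong (_* 2) e ⟩
      2 ^ k * o * 2        ≡⟨ 2^[1+k]*o≡2^k*o*2 k o ⟨
      2 ^ suc k * o        ∎)
      where o = suc (i * 2)

  odd*odd : ∀ i j → suc (i * 2) * suc (j * 2) ≡ suc ((i + j + i * j * 2) * 2)
  odd*odd = solve-∀

  ν₂-* : ∀ m n .{{_ : NonZero m}} .{{_ : NonZero n}} → ν₂ (m * n) ≡ ν₂ m + ν₂ n
  ν₂-* m n with odd-part m | odd-part n
  ... | k , i , refl | l , j , refl = begin
    ν₂ (2 ^ k * o₁ * (2 ^ l * o₂))             ≡⟨ cong ν₂ (rearrange (2 ^ k) (2 ^ l) o₁ o₂) ⟩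
    ν₂ (2 ^ k * 2 ^ l * (o₁ * o₂))             ≡⟨ cong₂ (λ p o → ν₂ (p * o)) (^-distribˡ-+-* 2 k l) (sym (odd*odd i j)) ⟨
    ν₂ (2 ^ (k + l) * suc ((i + j + i * j * 2) * 2)) ≡⟨ ν₂-2^k*odd (k + l) (i + j + i * j * 2) ⟩
    k + l                                      ≡⟨ cong₂ _+_ (ν₂-2^k*odd k i) (ν₂-2^k*odd l j) ⟨
    ν₂ (2 ^ k * o₁) + ν₂ (2 ^ l * o₂)          ∎
    where
    o₁ = suc (i * 2)
    o₂ = suc (j * 2)
    rearrange : ∀ p q x y → p * x * (q * y) ≡ p * q * (x * y)
    rearrange = solve-∀

open import Defs
open import Data.List using (List)
open import Data.Integer using (+_; _+_)
open import Data.Product using (_×_)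
open import Relation.Binary.PropositionalEquality using (_≡_)

open Valuation
open import Data.Nat as ℕ using (ℕ; suc; NonZero; _<_; _≟_; ≢-nonZero)
import Data.Nat.Properties as ℕ
import Data.Nat.Divisibility as ℕ
open import Data.Nat.DivMod using (_/_; m/n*n≡m; m≥n⇒m/n>0)
open import Data.Nat.GCD using (gcd; gcd[m,n]∣m; gcd[m,n]∣n; gcd[m,n]≢0; gcd-comm; m/gcd[m,n]≢0; n/gcd[m,n]≢0)
open import Data.Nat.Coprimality using (Coprime; coprime-/gcd)
open import Data.Integer using (ℤ; -_; _*_)
open import Data.Integer.Properties using (neg-involutive; pos-+; pos-*; neg-distribˡ-*; +-identityˡ; +-comm; *-cancelʳ-≡)
open import Data.Integer.Divisibility.Signed
open import Data.Integer.DivMod using (_%ℕ_; _/ℕ_; n%ℕd<d; a≡a%ℕn+[a/ℕn]*n)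
open import Data.Integer.Tactic.RingSolver using (solve-∀)
open import Data.Product using (∃; _,_; proj₁; proj₂)
open import Data.Sum using (inj₁)
open import Data.Empty using (⊥-elim)
open import Function.Base using (_∘_)
open import Function.Bundles using (_⇔_; mk⇔; Equivalence)
open import Function.Construct.Symmetry using (⇔-sym)
open import Function.Construct.Composition using (_⇔-∘_)
open import Function.Related.Propositional using (module EquationalReasoning)
open import Function.Related.TypeIsomorphisms using (¬-cong-⇔)
open import Relation.Nullary using (¬_; yes; no; contradiction)
open import Relation.Binary.Definitions using (tri<; tri≈; tri>)
open import Relation.Binary.PropositionalEquality using (_≢_; refl; sym; trans; cong; cong₂; subst; module ≡-Reasoning)

Even : ℤ → Set
Even z = + 2 ∣ z

even-* : ∀ q → Even (q * + 2)
even-* q = divides q refl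

even-+ : ∀ {x y} → Even x → Even y → Even (x + y)
even-+ = ∣m∣n⇒∣m+n

even-+-cancelʳ : ∀ {x y} → Even (x + y) → Even y → Even x
even-+-cancelʳ = ∣m+n∣n⇒∣m

even-neg⇔ : ∀ z → Even (- z) ⇔ Even z
even-neg⇔ z = mk⇔ (subst Even (neg-involutive z) ∘ ∣m⇒∣-m) ∣m⇒∣-m

¬even⇒odd : ∀ {z} → ¬ Even z → ∃ λ q → z ≡ + 1 + q * + 2
¬even⇒odd {z} ¬ez with z %ℕ 2 | n%ℕd<d z 2 | a≡a%ℕn+[a/ℕn]*n z 2
... | 0           | _                  | z≡ = contradiction (subst Even (sym (trans z≡ (+-identityˡ _))) (even-* (z /ℕ 2))) ¬ez
... | 1           | _                  | z≡ = z /ℕ 2 , z≡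
... | suc (suc _) | ℕ.s≤s (ℕ.s≤s ()) | _

odd-+-odd : ∀ {x y} → ¬ Even x → ¬ Even y → Even (x + y)
odd-+-odd ¬ex ¬ey with ¬even⇒odd ¬ex | ¬even⇒odd ¬ey
... | q , x≡ | r , y≡ = subst Even (sym (trans (cong₂ _+_ x≡ y≡) (odd+odd q r))) (even-* (+ 1 + q + r))
  where
  odd+odd : ∀ q r → (+ 1 + q * + 2) + (+ 1 + r * + 2) ≡ (+ 1 + q + r) * + 2
  odd+odd = solve-∀

+-even⇔ : ∀ {s} → Even s → ∀ k → Even (k + s) ⇔ Even k
+-even⇔ es k = mk⇔ (λ eks → even-+-cancelʳ eks es) (λ ek → even-+ ek es)

+-odd⇔ : ∀ {s} → ¬ Even s → ∀ k → Even (k + s) ⇔ (¬ Even k)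
+-odd⇔ {s} ¬es k = mk⇔ (λ eks ek → ¬es (even-+-cancelʳ (subst Even (+-comm k s) eks) ek))
                        (λ ¬ek → odd-+-odd ¬ek ¬es)

even-+[j*2] : ∀ j → Even (+ (j ℕ.* 2))
even-+[j*2] j = subst Even (sym (pos-* j 2)) (even-* (+ j))

¬even-+[1+j*2] : ∀ j → ¬ Even (+ suc (j ℕ.* 2))
¬even-+[1+j*2] j e = contradiction (ℕ.∣1⇒≡1 (∣⇒∣ᵤ {+ 2} {+ 1} 2∣1)) λ ()
  where
  2∣1 : Even (+ 1)
  2∣1 = even-+-cancelʳ (subst Even (pos-+ 1 (j ℕ.* 2)) e) (even-+[j*2] j)

signed : Sign → ℕ → ℤ
signed plus  n = + n
signed minus n = - + n

val≡signed : ∀ x → val x ≡ signed (sgn x) (mag x)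
val≡signed (plus  · _) = refl
val≡signed (minus · _) = refl

signed-* : ∀ s m n → signed s (m ℕ.* n) ≡ signed s m * + n
signed-* plus  m n = pos-* m n
signed-* minus m n = trans (cong -_ (pos-* m n)) (neg-distribˡ-* (+ m) (+ n))

even-signed⇔ : ∀ s n → Even (signed s n) ⇔ Even (+ n)
even-signed⇔ plus  n = mk⇔ (λ e → e) (λ e → e)
even-signed⇔ minus n = even-neg⇔ (+ n)

even-signed[j*2] : ∀ s j → Even (signed s (j ℕ.* 2))
even-signed[j*2] s j = Equivalence.from (even-signed⇔ s _) (even-+[j*2] j)

¬even-signed[1+j*2] : ∀ s j → ¬ Even (signed s (suc (j ℕ.* 2)))
¬even-signed[1+j*2] s j = ¬even-+[1+j*2] j ∘ Equivalence.to (even-signed⇔ s _)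

¬even-signed-odd+even : ∀ s t i j → ¬ Even (signed s (suc (i ℕ.* 2)) + signed t (j ℕ.* 2))
¬even-signed-odd+even s t i j e = ¬even-signed[1+j*2] s i (even-+-cancelʳ e (even-signed[j*2] t j))

ν₂-odd≢ν₂-even : ∀ i j .{{_ : NonZero (j ℕ.* 2)}} → ν₂ (suc (i ℕ.* 2)) ≢ ν₂ (j ℕ.* 2)
ν₂-odd≢ν₂-even i j eq = ℕ.0≢1+n (trans (sym (ν₂-odd i)) (trans eq (ν₂-double j {{ℕ.m*n≢0⇒m≢0 j}})))

even-signed-+⇔ν₂≡ : ∀ s t m n .{{_ : NonZero m}} .{{_ : NonZero n}} → Coprime m n →
                    Even (signed s m + signed t n) ⇔ (ν₂ m ≡ ν₂ n)
even-signed-+⇔ν₂≡ s t m n coprime with parityView m | parityView n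
... | even i | even j with () ← coprime (ℕ.divides i refl , ℕ.divides j refl)
... | odd i  | odd j  = mk⇔ (λ _ → trans (ν₂-odd i) (sym (ν₂-odd j)))
                            (λ _ → odd-+-odd (¬even-signed[1+j*2] s i) (¬even-signed[1+j*2] t j))
... | odd i  | even j = mk⇔ (⊥-elim ∘ ¬even-signed-odd+even s t i j) (⊥-elim ∘ ν₂-odd≢ν₂-even i j)
... | even i | odd j  = mk⇔ (⊥-elim ∘ ¬even-signed-odd+even t s j i ∘ subst Even (+-comm (signed s _) _))
                            (⊥-elim ∘ ν₂-odd≢ν₂-even j i ∘ sym)

gcd-nonZero : ∀ m n .{{_ : NonZero m}} → NonZero (gcd m n)
gcd-nonZero m n = ≢-nonZero (gcd[m,n]≢0 m n (inj₁ (ℕ.≢-nonZero⁻¹ m)))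

ν₂-/ : ∀ {m d} .{{_ : NonZero m}} .{{_ : NonZero d}} → d ℕ.∣ m → ν₂ m ≡ ν₂ (m / d) ℕ.+ ν₂ d
ν₂-/ {m} {d} d∣m = trans (cong ν₂ (sym (m/n*n≡m d∣m))) (ν₂-* (m / d) d {{m/d≢0}})
  where
  m/d≢0 : NonZero (m / d)
  m/d≢0 = ℕ.>-nonZero (m≥n⇒m/n>0 (ℕ.∣⇒≤ d∣m))

ν₂≡⇔ν₂/≡ : ∀ {m n d} .{{_ : NonZero m}} .{{_ : NonZero n}} .{{_ : NonZero d}} →
           d ℕ.∣ m → d ℕ.∣ n → (ν₂ m ≡ ν₂ n) ⇔ (ν₂ (m / d) ≡ ν₂ (n / d))
ν₂≡⇔ν₂/≡ {d = d} d∣m d∣n = mk⇔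
  (λ eq → ℕ.+-cancelʳ-≡ (ν₂ d) _ _ (trans (sym (ν₂-/ d∣m)) (trans eq (ν₂-/ d∣n))))
  (λ eq → trans (ν₂-/ d∣m) (trans (cong (ℕ._+ ν₂ d) eq) (sym (ν₂-/ d∣n))))

even-reduced-ends⇔ : ∀ s t m n .{{_ : NonZero m}} .{{_ : NonZero n}} .{{_ : NonZero (gcd m n)}} →
                     Even (signed s (m / gcd m n) + signed t (n / gcd m n)) ⇔ (ν₂ m ≡ ν₂ n)
even-reduced-ends⇔ s t m n =
  ⇔-sym (ν₂≡⇔ν₂/≡ (gcd[m,n]∣m m n) (gcd[m,n]∣n m n)) ⇔-∘
  even-signed-+⇔ν₂≡ s t (m / gcd m n) (n / gcd m n)
    {{≢-nonZero (m/gcd[m,n]≢0 m n)}} {{≢-nonZero (n/gcd[m,n]≢0 m n)}} (coprime-/gcd m n)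

val≡signed[/]* : ∀ x {d} .{{_ : NonZero d}} → d ℕ.∣ mag x → val x ≡ signed (sgn x) (mag x / d) * + d
val≡signed[/]* x {d} d∣x = begin
  val x                                ≡⟨ val≡signed x ⟩
  signed (sgn x) (mag x)               ≡⟨ cong (signed (sgn x)) (m/n*n≡m d∣x) ⟨
  signed (sgn x) (mag x / d ℕ.* d)     ≡⟨ signed-* (sgn x) (mag x / d) d ⟩
  signed (sgn x) (mag x / d) * + d     ∎
  where open ≡-Reasoning

cycle-quotient : ∀ {A I B K} g k α β → A + I + B + K ≡ + 0 →
                 A ≡ α * g → I ≡ k * g → B ≡ β * g → K ≡ - (k + (α + β)) * g
cycle-quotient {K = K} g k α β cycle refl refl refl = begin
  K                      ≡⟨ isolate S K ⟩
  - S + (S + K)          ≡⟨ cong (λ t → - S + t) cycle ⟩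
  - S + + 0              ≡⟨ factor g k α β ⟩
  - (k + (α + β)) * g    ∎
  where
  open ≡-Reasoning
  S = α * g + k * g + β * g
  isolate : ∀ S K → K ≡ - S + (S + K)
  isolate = solve-∀
  factor : ∀ g k α β → - (α * g + k * g + β * g) + + 0 ≡ - (k + (α + β)) * g
  factor = solve-∀

negSign-swap : ∀ s t → (s ≡ negSign t) ⇔ (t ≡ negSign s)
negSign-swap plus  minus = mk⇔ (λ _ → refl) (λ _ → refl)
negSign-swap minus plus  = mk⇔ (λ _ → refl) (λ _ → refl)
negSign-swap plus  plus  = mk⇔ (λ ()) (λ ())
negSign-swap minus minus = mk⇔ (λ ()) (λ ())

≡negSign⇔≢ : ∀ s t → (s ≡ negSign t) ⇔ (s ≢ t)
≡negSign⇔≢ plus  minus = mk⇔ (λ _ ()) (λ _ → refl)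
≡negSign⇔≢ minus plus  = mk⇔ (λ _ ()) (λ _ → refl)
≡negSign⇔≢ plus  plus  = mk⇔ (λ ()) (λ s≢s → contradiction refl s≢s)
≡negSign⇔≢ minus minus = mk⇔ (λ ()) (λ s≢s → contradiction refl s≢s)

module _ (P : Pattern) where
  private
    ν₁ = ν₂ (mag (first P))
    νₘ = ν₂ (mag (last P))
    ε₁ = sgn (first P)
    εₘ = sgn (last P)

  signRule-≡⇔ : ν₁ ≡ νₘ → SignRule P ⇔ (ε₁ ≡ negSign εₘ)
  signRule-≡⇔ eq = mk⇔ (λ (_ , _ , rule) → rule eq)
    (λ e → (λ lt → ⊥-elim (ℕ.<-irrefl eq lt)) , (λ gt → ⊥-elim (ℕ.<-irrefl (sym eq) gt)) , (λ _ → e))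

  signRule-<⇔ : ν₁ < νₘ → SignRule P ⇔ (ε₁ ≡ minus)
  signRule-<⇔ lt = mk⇔ (λ (rule , _ , _) → rule lt)
    (λ e → (λ _ → e) , (λ gt → ⊥-elim (ℕ.<-asym lt gt)) , (λ eq → ⊥-elim (ℕ.<-irrefl eq lt)))

  signRule->⇔ : νₘ < ν₁ → SignRule P ⇔ (εₘ ≡ plus)
  signRule->⇔ gt = mk⇔ (λ (_ , rule , _) → rule gt)
    (λ e → (λ lt → ⊥-elim (ℕ.<-asym lt gt)) , (λ _ → e) , (λ eq → ⊥-elim (ℕ.<-irrefl (sym eq) gt)))

module _ {a b : SignedPos} {I K : List SignedPos} where
  open EquationalReasoning

  signRule-swap-≡ : ν₂ (mag a) ≡ ν₂ (mag b) → SignRule (pat a I b) ⇔ SignRule (pat b K a)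
  signRule-swap-≡ eq = begin
    SignRule (pat a I b)     ∼⟨ signRule-≡⇔ (pat a I b) eq ⟩
    sgn a ≡ negSign (sgn b)  ∼⟨ negSign-swap (sgn a) (sgn b) ⟩
    sgn b ≡ negSign (sgn a)  ∼⟨ ⇔-sym (signRule-≡⇔ (pat b K a) (sym eq)) ⟩
    SignRule (pat b K a)     ∎

  signRule-swap-≢ : ν₂ (mag a) ≢ ν₂ (mag b) → SignRule (pat b K a) ⇔ (¬ SignRule (pat a I b))
  signRule-swap-≢ ν≢ with ℕ.<-cmp (ν₂ (mag a)) (ν₂ (mag b))
  ... | tri< lt _ _ = begin
    SignRule (pat b K a)      ∼⟨ signRule->⇔ (pat b K a) lt ⟩
    sgn a ≡ plus              ∼⟨ ≡negSign⇔≢ (sgn a) minus ⟩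
    sgn a ≢ minus             ∼⟨ ¬-cong-⇔ (⇔-sym (signRule-<⇔ (pat a I b) lt)) ⟩
    (¬ SignRule (pat a I b))  ∎
  ... | tri≈ _ eq _ = contradiction eq ν≢
  ... | tri> _ _ gt = begin
    SignRule (pat b K a)      ∼⟨ signRule-<⇔ (pat b K a) gt ⟩
    sgn b ≡ minus             ∼⟨ ≡negSign⇔≢ (sgn b) plus ⟩
    sgn b ≢ plus              ∼⟨ ¬-cong-⇔ (⇔-sym (signRule->⇔ (pat a I b) gt)) ⟩
    (¬ SignRule (pat a I b))  ∎

quotEven⇔ : ∀ P {k} → interiorSum P ≡ k * + gcdEnds P → QuotEven P ⇔ Even k
quotEven⇔ P {k} I≡ = mk⇔
  (λ (k′ , I≡′ , 2∣k′) → subst Even (k′≡k I≡′) (∣ᵤ⇒∣ {+ 2} {k′} 2∣k′))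
  (λ 2∣k → k , I≡ , ∣⇒∣ᵤ 2∣k)
  where
  instance _ = gcd-nonZero (mag (first P)) (mag (last P))
  k′≡k : ∀ {k′} → interiorSum P ≡ k′ * + gcdEnds P → k′ ≡ k
  k′≡k {k′} I≡′ = *-cancelʳ-≡ k′ k (+ gcdEnds P) (trans (sym I≡′) I≡)

divPar-transfer : ∀ a b I K → val a + sumVal I + val b + sumVal K ≡ + 0 →
                  DivPar (pat a I b) → DivPar (pat b K a)
divPar-transfer a b I K cycle (divP , parP) = divQ , λ _ → Equivalence.to parityQ , Equivalence.from parityQ
  where
  open EquationalReasoning
  g = gcd (mag a) (mag b)
  instance
    g≢0 : NonZero g
    g≢0 = gcd-nonZero (mag a) (mag b)
  α = signed (sgn a) (mag a / g)
  β = signed (sgn b) (mag b / g)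
  open _∣_ (∣ᵤ⇒∣ {+ g} {sumVal I} divP) renaming (quotient to k; equality to I≡)

  K≡ : sumVal K ≡ - (k + (α + β)) * + gcdEnds (pat b K a)
  K≡ = trans (cycle-quotient (+ g) k α β cycle (val≡signed[/]* a (gcd[m,n]∣m (mag a) (mag b)))
                                               I≡
                                               (val≡signed[/]* b (gcd[m,n]∣n (mag a) (mag b))))
             (cong (λ h → - (k + (α + β)) * + h) (gcd-comm (mag a) (mag b)))

  divQ : Divisibility (pat b K a)
  divQ = ∣⇒∣ᵤ {+ gcdEnds (pat b K a)} {sumVal K} (divides (- (k + (α + β))) K≡)

  parityP : Even k ⇔ SignRule (pat a I b)
  parityP = mk⇔ (proj₁ (parP divP)) (proj₂ (parP divP)) ⇔-∘ ⇔-sym (quotEven⇔ (pat a I b) I≡)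

  ends : Even (α + β) ⇔ (ν₂ (mag a) ≡ ν₂ (mag b))
  ends = even-reduced-ends⇔ (sgn a) (sgn b) (mag a) (mag b)

  parityQ : QuotEven (pat b K a) ⇔ SignRule (pat b K a)
  parityQ with ν₂ (mag a) ≟ ν₂ (mag b)
  ... | yes ν≡ = begin
    QuotEven (pat b K a)      ∼⟨ quotEven⇔ (pat b K a) K≡ ⟩
    Even (- (k + (α + β)))    ∼⟨ even-neg⇔ _ ⟩
    Even (k + (α + β))        ∼⟨ +-even⇔ (Equivalence.from ends ν≡) k ⟩
    Even k                    ∼⟨ parityP ⟩
    SignRule (pat a I b)      ∼⟨ signRule-swap-≡ {I = I} {K} ν≡ ⟩
    SignRule (pat b K a)      ∎
  ... | no ν≢ = begin
    QuotEven (pat b K a)      ∼⟨ quotEven⇔ (pat b K a) K≡ ⟩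
    Even (- (k + (α + β)))    ∼⟨ even-neg⇔ _ ⟩
    Even (k + (α + β))        ∼⟨ +-odd⇔ (ν≢ ∘ Equivalence.to ends) k ⟩
    (¬ Even k)                ∼⟨ ¬-cong-⇔ parityP ⟩
    (¬ SignRule (pat a I b))  ∼⟨ ⇔-sym (signRule-swap-≢ {I = I} {K} ν≢) ⟩
    SignRule (pat b K a)      ∎

claim17 : (a b : SignedPos) (I K : List SignedPos) →
    val a + sumVal I + val b + sumVal K ≡ + 0 →
    (DivPar (pat a I b) → DivPar (pat b K a)) × (DivPar (pat b K a) → DivPar (pat a I b))
claim17 a b I K cycle =
  divPar-transfer a b I K cycle ,
  divPar-transfer b a K I (trans (rotate (val b) (sumVal K) (val a) (sumVal I)) cycle)
  where
  rotate : ∀ B K A I → B + K + A + I ≡ A + I + B + K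
  rotate = solve-∀
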